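{- For all nonnegative integers $m$ and $n$, the number of partitions $\lambda$ into distinct parts with largest part $\lambda_1=m$ and $\lambda_1+\lambda_3+\lambda_5+\cdots=n$ equals the number of partitions of $n$ whose largest hook length equals $m$.
   Context: Partitions are written $\lambda_1\ge\lambda_2\ge\cdots$ with $\lambda_i=0$ beyond the number of parts $\ell(\lambda)$; a partition into distinct parts has strictly decreasing nonzero parts. The largest hook length of a nonempty partition $\mu$ is the hook length of the cell $(1,1)$ of its Young diagram, namely $\mu_1+\ell(\mu)-1$; the empty partition has largest part $0$ and largest hook length $0$. -}

module Defs where

open import Data.Nat using (ℕ; zero; suc; _+_; _<_; _≥_; _>_)
open import Data.List using (List; []; _∷_; length)
open import Data.Nat.ListAction using (sum)
open import Data.List.Relation.Unary.All using (All)
open import Data.List.Relation.Unary.Linked using (Linked)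
open import Data.Product using (_×_; Σ)
open import Relation.Binary.PropositionalEquality using (_≡_)

IsPartition : List ℕ → Set
IsPartition l = Linked _≥_ l × All (λ x → 0 < x) l

IsDistinctPartition : List ℕ → Set
IsDistinctPartition l = Linked _>_ l × All (λ x → 0 < x) l

largestPart : List ℕ → ℕ
largestPart []      = 0
largestPart (x ∷ _) = x

-- λ₁ + λ₃ + λ₅ + ⋯ (odd positions, 1-indexed)
oddPositionSum  : List ℕ → ℕ
evenPositionSum : List ℕ → ℕ
oddPositionSum  []       = 0
oddPositionSum  (x ∷ xs) = x + evenPositionSum xs
evenPositionSum []       = 0
evenPositionSum (_ ∷ xs) = oddPositionSum xs

-- largest hook length: μ₁ + ℓ(μ) − 1 = μ₁ + length of the tail; 0 for empty
largestHook : List ℕ → ℕ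
largestHook []       = 0
largestHook (x ∷ xs) = x + length xs

DistinctOdd : ℕ → ℕ → Set
DistinctOdd m n = Σ (List ℕ) λ l →
  IsDistinctPartition l × largestPart l ≡ m × oddPositionSum l ≡ n

HookPartitions : ℕ → ℕ → Set
HookPartitions m n = Σ (List ℕ) λ l →
  IsPartition l × sum l ≡ n × largestHook l ≡ m

module Submission where

open import Data.Empty using (⊥-elim)
open import Data.Fin using (Fin; zero; suc; toℕ; fromℕ<)
open import Data.Fin.Properties using (1↔⊤; +↔⊎; toℕ<n; toℕ-fromℕ<; fromℕ<-toℕ)
open import Data.List using (List; []; _∷_; length; replicate)
open import Data.List.Properties using (length-replicate; ∷-injective)
open import Data.List.Relation.Unary.All as All using (All; []; _∷_; all?)
open import Data.List.Relation.Unary.Linked as Linked using (Linked; []; [-]; _∷_; linked?)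
open import Data.Nat using (ℕ; zero; suc; _+_; _∸_; _≤_; _<_; _≥_; z≤n; s≤s; s≤s⁻¹; _≟_; _≤?_; _<?_)
open import Data.Nat.ListAction using (sum)
open import Data.Nat.Properties
open import Algebra.Properties.CommutativeSemigroup +-commutativeSemigroup using (x∙yz≈y∙xz)
open import Data.Product using (Σ; ∃; ∃₂; _×_; _,_; proj₁; proj₂)
open import Data.Product.Function.Dependent.Propositional using (Σ-↔)
open import Data.Product.Properties using (Σ-≡,≡→≡)
open import Data.Sum using (_⊎_; inj₁; inj₂)
open import Data.Sum.Function.Propositional using (_⊎-↔_)
open import Data.Unit using (⊤; tt)
open import Function.Bundles using (_↔_; mk↔ₛ′; Inverse)
open import Function.Properties.Inverse using (↔-refl; ↔-sym; ↔-trans)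
open import Relation.Binary.PropositionalEquality
open import Relation.Nullary using (Dec; yes; no; Irrelevant)
open import Relation.Nullary.Decidable using (_×-dec_)

open import Defs

-- Cut the Young diagram of a partition μ into its diagonal hooks: the
-- i-th one consists of the cells (i,j) and (j,i) with j ≥ i.  Record for each i the
-- hook lengths of the cells (i,i) and (i+1,i); reading these numbers in order,
-- h(1,1) > h(2,1) > h(2,2) > h(3,2) > ⋯, gives a partition λ into distinct parts
-- with λ₁ = h(1,1), the largest hook length of μ, and λ₁ + λ₃ + ⋯ = Σᵢ h(i,i) = |μ|.
-- Conversely μ is rebuilt from λ by wrapping hooks around one another from the
-- inside out, so the two sets are in bijection; both are finite because a
-- partition of n has at most n parts, each at most n.

Finite : Set → Set
Finite A = Σ ℕ λ k → A ↔ Fin k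

↔-finite : {A B : Set} → A ↔ B → Finite B → Finite A
↔-finite A↔B (k , B↔Fin) = k , ↔-trans A↔B B↔Fin

Dec⇒finite : {A : Set} → Dec A → Irrelevant A → Finite A
Dec⇒finite (yes a) irr = 1 , mk↔ₛ′ (λ _ → zero) (λ _ → a) (λ { zero → refl }) (irr a)
Dec⇒finite (no ¬a) _   = 0 , mk↔ₛ′ (λ a → ⊥-elim (¬a a)) (λ ()) (λ ()) (λ a → ⊥-elim (¬a a))

⊎-finite : {A B : Set} → Finite A → Finite B → Finite (A ⊎ B)
⊎-finite (i , A↔Fin) (j , B↔Fin) = i + j , ↔-trans (A↔Fin ⊎-↔ B↔Fin) (↔-sym +↔⊎)

Σ-Fin-suc-↔ : ∀ {k} (P : Fin (suc k) → Set) → Σ (Fin (suc k)) P ↔ (P zero ⊎ Σ (Fin k) (λ i → P (suc i)))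
Σ-Fin-suc-↔ P = mk↔ₛ′
  (λ { (zero , p) → inj₁ p ; (suc i , p) → inj₂ (i , p) })
  (λ { (inj₁ p) → zero , p ; (inj₂ (i , p)) → suc i , p })
  (λ { (inj₁ p) → refl ; (inj₂ (i , p)) → refl })
  (λ { (zero , p) → refl ; (suc i , p) → refl })

Σ-Fin-finite : ∀ k {P : Fin k → Set} → (∀ i → Finite (P i)) → Finite (Σ (Fin k) P)
Σ-Fin-finite zero    _ = 0 , mk↔ₛ′ (λ { (() , _) }) (λ ()) (λ ()) (λ { (() , _) })
Σ-Fin-finite (suc k) {P} fin =
  ↔-finite (Σ-Fin-suc-↔ P) (⊎-finite (fin zero) (Σ-Fin-finite k (λ i → fin (suc i))))

Σ-finite : {A : Set} {P : A → Set} → Finite A → (∀ a → Finite (P a)) → Finite (Σ A P)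
Σ-finite (k , A↔Fin) fin =
  ↔-finite (↔-sym (Σ-↔ (↔-sym A↔Fin) ↔-refl)) (Σ-Fin-finite k (λ i → fin (Inverse.from A↔Fin i)))

Σ-↔-bijectiveOn : {A B : Set} {P : A → Set} {Q : B → Set} (f : A → B) →
  (∀ {a} → P a → Q (f a)) →
  (∀ {a a′} → P a → P a′ → f a ≡ f a′ → a ≡ a′) →
  (∀ {b} → Q b → ∃ λ a → P a × f a ≡ b) →
  (∀ a → Irrelevant (P a)) → (∀ b → Irrelevant (Q b)) →
  Σ A P ↔ Σ B Q
Σ-↔-bijectiveOn {A} {B} {P} {Q} f maps injective surjective P-irr Q-irr = mk↔ₛ′ to from to∘from from∘to
  where
  to : Σ A P → Σ B Q
  to (a , p) = f a , maps p
  from : Σ B Q → Σ A P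
  from (b , q) = proj₁ (surjective q) , proj₁ (proj₂ (surjective q))
  to∘from : ∀ y → to (from y) ≡ y
  to∘from (b , q) = Σ-≡,≡→≡ (proj₂ (proj₂ (surjective q)) , Q-irr b _ _)
  from∘to : ∀ x → from (to x) ≡ x
  from∘to (a , p) with surjective (maps p)
  ... | a′ , p′ , fa′≡fa = Σ-≡,≡→≡ (injective p′ p fa′≡fa , P-irr a _ _)

subset-finite : {A : Set} {R Q : A → Set} → Finite (Σ A R) → (∀ a → Irrelevant (R a)) →
  (∀ {a} → Q a → R a) → (∀ a → Dec (Q a)) → (∀ a → Irrelevant (Q a)) → Finite (Σ A Q)
subset-finite {A} {R} {Q} R-finite R-irr Q⇒R Q? Q-irr =
  ↔-finite (↔-sym (Σ-↔-bijectiveOn proj₁ (λ q → q) injective surjective (λ x → Q-irr (proj₁ x)) Q-irr))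
           (Σ-finite R-finite (λ x → Dec⇒finite (Q? (proj₁ x)) (Q-irr (proj₁ x))))
  where
  injective : ∀ {x x′ : Σ A R} → Q (proj₁ x) → Q (proj₁ x′) → proj₁ x ≡ proj₁ x′ → x ≡ x′
  injective _ _ a≡a′ = Σ-≡,≡→≡ (a≡a′ , R-irr _ _ _)
  surjective : ∀ {a} → Q a → ∃ λ (x : Σ A R) → Q (proj₁ x) × proj₁ x ≡ a
  surjective {a} q = (a , Q⇒R q) , q , refl

×-irrelevant : {A B : Set} → Irrelevant A → Irrelevant B → Irrelevant (A × B)
×-irrelevant A-irr B-irr (a , b) (a′ , b′) = cong₂ _,_ (A-irr a a′) (B-irr b b′)

Bounded : ℕ → ℕ → List ℕ → Set
Bounded B L l = All (_< B) l × length l ≤ L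

Bounded-irrelevant : ∀ B L l → Irrelevant (Bounded B L l)
Bounded-irrelevant B L l = ×-irrelevant (All.irrelevant <-irrelevant) ≤-irrelevant

Bounded-suc-↔ : ∀ B L → Σ (List ℕ) (Bounded B (suc L)) ↔ (⊤ ⊎ (Fin B × Σ (List ℕ) (Bounded B L)))
Bounded-suc-↔ B L = mk↔ₛ′ to from to∘from from∘to
  where
  to : Σ (List ℕ) (Bounded B (suc L)) → ⊤ ⊎ (Fin B × Σ (List ℕ) (Bounded B L))
  to ([] , _)                            = inj₁ tt
  to (x ∷ l , x<B ∷ l<B , s≤s length≤L) = inj₂ (fromℕ< x<B , l , l<B , length≤L)
  from : ⊤ ⊎ (Fin B × Σ (List ℕ) (Bounded B L)) → Σ (List ℕ) (Bounded B (suc L))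
  from (inj₁ tt)                          = [] , [] , z≤n
  from (inj₂ (i , l , l<B , length≤L))    = toℕ i ∷ l , toℕ<n i ∷ l<B , s≤s length≤L
  to∘from : ∀ y → to (from y) ≡ y
  to∘from (inj₁ tt)                       = refl
  to∘from (inj₂ (i , l , l<B , length≤L)) =
    cong (λ j → inj₂ (j , l , l<B , length≤L)) (fromℕ<-toℕ i (toℕ<n i))
  from∘to : ∀ x → from (to x) ≡ x
  from∘to ([] , [] , z≤n) = refl
  from∘to (x ∷ l , x<B ∷ _ , s≤s _) =
    Σ-≡,≡→≡ (cong (_∷ l) (toℕ-fromℕ< x<B) , Bounded-irrelevant B (suc L) (x ∷ l) _ _)

Bounded-finite : ∀ B L → Finite (Σ (List ℕ) (Bounded B L))
Bounded-finite B zero =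
  1 , mk↔ₛ′ (λ _ → zero) (λ _ → [] , [] , z≤n) (λ { zero → refl }) (λ { ([] , [] , z≤n) → refl })
Bounded-finite B (suc L) =
  ↔-finite (Bounded-suc-↔ B L)
           (⊎-finite (1 , ↔-sym 1↔⊤) (Σ-finite (B , ↔-refl) (λ _ → Bounded-finite B L)))

IsPartition? : ∀ l → Dec (IsPartition l)
IsPartition? l = linked? (λ x y → y ≤? x) l ×-dec all? (0 <?_) l

IsPartition-irrelevant : ∀ l → Irrelevant (IsPartition l)
IsPartition-irrelevant l = ×-irrelevant (Linked.irrelevant ≤-irrelevant) (All.irrelevant <-irrelevant)

IsDistinctPartition-irrelevant : ∀ l → Irrelevant (IsDistinctPartition l)
IsDistinctPartition-irrelevant l = ×-irrelevant (Linked.irrelevant <-irrelevant) (All.irrelevant <-irrelevant)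

distinct-tail : ∀ {x l} → IsDistinctPartition (x ∷ l) → IsDistinctPartition l
distinct-tail (lk , _ ∷ ps) = Linked.tail lk , ps

linked-largestPart : ∀ {x xs} → Linked _≥_ (x ∷ xs) → largestPart xs ≤ x
linked-largestPart [-]       = z≤n
linked-largestPart (x≥y ∷ _) = x≥y

largestPart-linked : ∀ {x xs} → largestPart xs ≤ x → Linked _≥_ xs → Linked _≥_ (x ∷ xs)
largestPart-linked _   []          = [-]
largestPart-linked x≥y [-]         = x≥y ∷ [-]
largestPart-linked x≥y lk@(_ ∷ _) = x≥y ∷ lk

All-≤-sum : ∀ l → All (_≤ sum l) l
All-≤-sum []      = []
All-≤-sum (x ∷ l) = m≤m+n x (sum l) ∷ All.map (λ y≤ → ≤-trans y≤ (m≤n+m (sum l) x)) (All-≤-sum l)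

length≤sum : ∀ {l} → All (0 <_) l → length l ≤ sum l
length≤sum []        = z≤n
length≤sum (x>0 ∷ p) = +-mono-≤ x>0 (length≤sum p)

partition-bounded : ∀ {l} → IsPartition l → Bounded (suc (sum l)) (sum l) l
partition-bounded {l} (_ , ps) = All.map s≤s (All-≤-sum l) , length≤sum ps

-- For a nonempty partition this is its largest hook length plus one.
hookBound : List ℕ → ℕ
hookBound ν = largestPart ν + length ν

-- Shift ν one column to the right and give the new first column k extra cells.
addColumn : ℕ → List ℕ → List ℕ
addColumn k []      = replicate k 1
addColumn k (x ∷ ν) = suc x ∷ addColumn k ν

length-addColumn : ∀ k ν → length (addColumn k ν) ≡ length ν + k
length-addColumn k []      = length-replicate k
length-addColumn k (x ∷ ν) = cong suc (length-addColumn k ν)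

sum-addColumn : ∀ k ν → sum (addColumn k ν) ≡ length (addColumn k ν) + sum ν
sum-addColumn zero    []      = refl
sum-addColumn (suc k) []      = cong suc (sum-addColumn k [])
sum-addColumn k       (x ∷ ν) = cong suc (begin
  x + sum (addColumn k ν)                ≡⟨ cong (x +_) (sum-addColumn k ν) ⟩
  x + (length (addColumn k ν) + sum ν)   ≡⟨ x∙yz≈y∙xz x _ (sum ν) ⟩
  length (addColumn k ν) + (x + sum ν)   ∎)
  where open ≡-Reasoning

addColumn-linked : ∀ k {y ν} → Linked _≥_ ν → largestPart ν < y → Linked _≥_ (y ∷ addColumn k ν)
addColumn-linked zero    {ν = []}    _  _   = [-]
addColumn-linked (suc k) {ν = []}    _  y>0 = y>0 ∷ addColumn-linked k [] (s≤s z≤n)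
addColumn-linked k       {ν = x ∷ ν} lk x<y =
  x<y ∷ addColumn-linked k (Linked.tail lk) (s≤s (linked-largestPart lk))

addColumn-positive : ∀ k ν → All (0 <_) (addColumn k ν)
addColumn-positive zero    []      = []
addColumn-positive (suc k) []      = s≤s z≤n ∷ addColumn-positive k []
addColumn-positive k       (x ∷ ν) = s≤s z≤n ∷ addColumn-positive k ν

-- Positivity of ν is what separates a shifted part from a cell of the new column.
addColumn-injective : ∀ {k k′ ν ν′} → All (0 <_) ν → All (0 <_) ν′ →
  addColumn k ν ≡ addColumn k′ ν′ → k ≡ k′ × ν ≡ ν′
addColumn-injective {k} {k′} {[]} {[]} _ _ eq =
  trans (sym (length-replicate k)) (trans (cong length eq) (length-replicate k′)) , refl
addColumn-injective {zero}  {_} {[]} {_ ∷ _} _ _ ()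
addColumn-injective {suc k} {_} {[]} {_ ∷ _} _ (x′>0 ∷ _) eq =
  ⊥-elim (<-irrefl (suc-injective (proj₁ (∷-injective eq))) x′>0)
addColumn-injective {_} {zero}  {_ ∷ _} {[]} _ _ ()
addColumn-injective {_} {suc k′} {_ ∷ _} {[]} (x>0 ∷ _) _ eq =
  ⊥-elim (<-irrefl (sym (suc-injective (proj₁ (∷-injective eq)))) x>0)
addColumn-injective {ν = x ∷ ν} {_ ∷ _} (_ ∷ ps) (_ ∷ ps′) eq
  with addColumn-injective ps ps′ (proj₂ (∷-injective eq))
... | refl , refl = refl , cong (_∷ ν) (suc-injective (proj₁ (∷-injective eq)))

addColumn-surjective : ∀ {x} t → IsPartition (x ∷ t) →
  ∃₂ λ ν k → IsPartition ν × largestPart ν < x × addColumn k ν ≡ t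
addColumn-surjective [] (_ , x>0 ∷ []) = [] , 0 , ([] , []) , x>0 , refl
addColumn-surjective (zero ∷ t) (_ , _ ∷ () ∷ _)
addColumn-surjective (suc zero ∷ t) (_ ∷ lk , x>0 ∷ ps) with addColumn-surjective t (lk , ps)
... | [] , k , _ , _ , refl = [] , suc k , ([] , []) , x>0 , refl
... | zero ∷ _ , _ , (_ , () ∷ _) , _ , _
... | suc _ ∷ _ , _ , _ , s≤s () , _
addColumn-surjective (suc (suc y) ∷ t) (x>y ∷ lk , _ ∷ ps) with addColumn-surjective t (lk , ps)
... | ν , k , (lkν , psν) , ν<y , refl =
  suc y ∷ ν , k , (largestPart-linked (s≤s⁻¹ ν<y) lkν , s≤s z≤n ∷ psν) , x>y , refl

wrap : ℕ → ℕ → List ℕ → List ℕ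
wrap a k ν = (largestPart ν + a) ∷ addColumn k ν

largestHook-wrap : ∀ a k ν → largestHook (wrap a k ν) ≡ a + (hookBound ν + k)
largestHook-wrap a k ν = begin
  (largestPart ν + a) + length (addColumn k ν)   ≡⟨ cong (largestPart ν + a +_) (length-addColumn k ν) ⟩
  (largestPart ν + a) + (length ν + k)           ≡⟨ cong (_+ (length ν + k)) (+-comm (largestPart ν) a) ⟩
  (a + largestPart ν) + (length ν + k)           ≡⟨ +-assoc a (largestPart ν) (length ν + k) ⟩
  a + (largestPart ν + (length ν + k))           ≡⟨ cong (a +_) (sym (+-assoc (largestPart ν) (length ν) k)) ⟩
  a + (hookBound ν + k)                          ∎
  where open ≡-Reasoning

sum-wrap : ∀ a k ν → sum (wrap a k ν) ≡ largestHook (wrap a k ν) + sum ν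
sum-wrap a k ν = trans (cong (largestPart ν + a +_) (sum-addColumn k ν)) (sym (+-assoc (largestPart ν + a) _ (sum ν)))

wrap-isPartition : ∀ {a} k {ν} → IsPartition ν → 0 < a → IsPartition (wrap a k ν)
wrap-isPartition {a} k {ν} (lk , _) a>0 =
  addColumn-linked k lk (m<m+n (largestPart ν) a>0) , ≤-trans a>0 (m≤n+m a (largestPart ν)) ∷ addColumn-positive k ν

wrap-injective : ∀ {a k ν a′ k′ ν′} → All (0 <_) ν → All (0 <_) ν′ →
  wrap a k ν ≡ wrap a′ k′ ν′ → a ≡ a′ × k ≡ k′ × ν ≡ ν′
wrap-injective {ν = ν} ps ps′ eq with addColumn-injective ps ps′ (proj₂ (∷-injective eq))
... | refl , refl = +-cancelˡ-≡ (largestPart ν) _ _ (proj₁ (∷-injective eq)) , refl , refl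

-- The hook with prescribed hook lengths m at (1,1) and b at (2,1)

attachHook : ℕ → ℕ → List ℕ → List ℕ
attachHook m b ν = wrap (m ∸ b) (b ∸ hookBound ν) ν

-- ν can be placed at cell (2,2) below such a hook.
Nestable : ℕ → ℕ → List ℕ → Set
Nestable m b ν = IsPartition ν × hookBound ν ≤ b × b < m

hookBound-attachHook : ∀ m b ν → hookBound (attachHook m b ν) ≡ suc (largestHook (attachHook m b ν))
hookBound-attachHook m b ν = +-suc _ _

largestHook-attachHook : ∀ {m b ν} → hookBound ν ≤ b → b ≤ m → largestHook (attachHook m b ν) ≡ m
largestHook-attachHook {m} {b} {ν} ν≤b b≤m = begin
  largestHook (attachHook m b ν)             ≡⟨ largestHook-wrap (m ∸ b) (b ∸ hookBound ν) ν ⟩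
  (m ∸ b) + (hookBound ν + (b ∸ hookBound ν)) ≡⟨ cong ((m ∸ b) +_) (m+[n∸m]≡n ν≤b) ⟩
  (m ∸ b) + b                                ≡⟨ m∸n+n≡m b≤m ⟩
  m                                          ∎
  where open ≡-Reasoning

sum-attachHook : ∀ {m b ν} → hookBound ν ≤ b → b ≤ m → sum (attachHook m b ν) ≡ m + sum ν
sum-attachHook {m} {b} {ν} ν≤b b≤m =
  trans (sum-wrap (m ∸ b) (b ∸ hookBound ν) ν) (cong (_+ sum ν) (largestHook-attachHook {ν = ν} ν≤b b≤m))

attachHook-isPartition : ∀ {m b ν} → IsPartition ν → b < m → IsPartition (attachHook m b ν)
attachHook-isPartition {b = b} {ν} p b<m = wrap-isPartition (b ∸ hookBound ν) p (m<n⇒0<n∸m b<m)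

attachHook-injective : ∀ {m b ν m′ b′ ν′} → Nestable m b ν → Nestable m′ b′ ν′ →
  attachHook m b ν ≡ attachHook m′ b′ ν′ → m ≡ m′ × b ≡ b′ × ν ≡ ν′
attachHook-injective ((_ , ps) , ν≤b , b<m) ((_ , ps′) , ν≤b′ , b′<m′) eq
  with wrap-injective ps ps′ eq
... | m∸b≡ , b∸≡ , refl with ∸-cancelʳ-≡ ν≤b ν≤b′ b∸≡
... | refl = ∸-cancelʳ-≡ (<⇒≤ b<m) (<⇒≤ b′<m′) m∸b≡ , refl , refl

attachHook-surjective : ∀ {x t} → IsPartition (x ∷ t) →
  ∃₂ λ m b → ∃ λ ν → Nestable m b ν × length ν ≤ length t × attachHook m b ν ≡ x ∷ t
attachHook-surjective {x} {t} p with addColumn-surjective t p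
... | ν , k , pν , ν<x , refl =
  a + b , b , ν , (pν , m≤m+n (hookBound ν) k , m<n+m b a>0)
  , subst (length ν ≤_) (sym (length-addColumn k ν)) (m≤m+n (length ν) k) , attachHook≡
  where
  open ≡-Reasoning
  a = x ∸ largestPart ν
  b = hookBound ν + k
  a>0 : 0 < a
  a>0 = m<n⇒0<n∸m ν<x
  attachHook≡ : attachHook (a + b) b ν ≡ x ∷ addColumn k ν
  attachHook≡ = begin
    attachHook (a + b) b ν
      ≡⟨ cong₂ (λ a′ k′ → wrap a′ k′ ν) (m+n∸n≡m a b) (m+n∸m≡n (hookBound ν) k) ⟩
    wrap a k ν              ≡⟨ cong (_∷ addColumn k ν) (m+[n∸m]≡n (<⇒≤ ν<x)) ⟩
    x ∷ addColumn k ν       ∎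

-- A lone last part m is paired with a zero second hook: attachHook m 0 [] is m ∷ [].
nestedHooks : List ℕ → List ℕ
nestedHooks []          = []
nestedHooks (m ∷ [])    = attachHook m 0 []
nestedHooks (m ∷ b ∷ r) = attachHook m b (nestedHooks r)

hookBound-nestedHooks-∷ : ∀ c r → hookBound (nestedHooks (c ∷ r)) ≡ suc (largestHook (nestedHooks (c ∷ r)))
hookBound-nestedHooks-∷ c []      = hookBound-attachHook c 0 []
hookBound-nestedHooks-∷ c (b ∷ r) = hookBound-attachHook c b (nestedHooks r)

largestHook-nestedHooks : ∀ {l} → IsDistinctPartition l → largestHook (nestedHooks l) ≡ largestPart l
hookBound-nestedHooks-≤ : ∀ {b r} → IsDistinctPartition (b ∷ r) → hookBound (nestedHooks r) ≤ b

largestHook-nestedHooks {[]}        _ = refl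
largestHook-nestedHooks {m ∷ []}    _ = +-identityʳ m
largestHook-nestedHooks {m ∷ b ∷ r} d@(b<m ∷ _ , _) =
  largestHook-attachHook {ν = nestedHooks r} (hookBound-nestedHooks-≤ (distinct-tail d)) (<⇒≤ b<m)

hookBound-nestedHooks-≤ {r = []}    _ = z≤n
hookBound-nestedHooks-≤ {r = c ∷ r} d@(c<b ∷ _ , _) = begin
  hookBound (nestedHooks (c ∷ r))        ≡⟨ hookBound-nestedHooks-∷ c r ⟩
  suc (largestHook (nestedHooks (c ∷ r))) ≡⟨ cong suc (largestHook-nestedHooks (distinct-tail d)) ⟩
  suc c                                  ≤⟨ c<b ⟩
  _                                      ∎
  where open ≤-Reasoning

hookBound-nestedHooks : ∀ {c r} → IsDistinctPartition (c ∷ r) → hookBound (nestedHooks (c ∷ r)) ≡ suc c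
hookBound-nestedHooks {c} {r} d = trans (hookBound-nestedHooks-∷ c r) (cong suc (largestHook-nestedHooks d))

nestedHooks-isPartition : ∀ {l} → IsDistinctPartition l → IsPartition (nestedHooks l)
nestedHooks-isPartition {[]}        _                = [] , []
nestedHooks-isPartition {m ∷ []}    (_ , m>0 ∷ [])   = attachHook-isPartition ([] , []) m>0
nestedHooks-isPartition {m ∷ b ∷ r} d@(b<m ∷ _ , _) =
  attachHook-isPartition (nestedHooks-isPartition (distinct-tail (distinct-tail d))) b<m

sum-nestedHooks : ∀ {l} → IsDistinctPartition l → sum (nestedHooks l) ≡ oddPositionSum l
sum-nestedHooks {[]}        _ = refl
sum-nestedHooks {m ∷ []}    _ = refl
sum-nestedHooks {m ∷ b ∷ r} d@(b<m ∷ _ , _) =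
  trans (sum-attachHook {ν = nestedHooks r} (hookBound-nestedHooks-≤ (distinct-tail d)) (<⇒≤ b<m))
        (cong (m +_) (sum-nestedHooks (distinct-tail (distinct-tail d))))

nestable-singleton : ∀ {m} → 0 < m → Nestable m 0 []
nestable-singleton m>0 = ([] , []) , z≤n , m>0

nestable-nestedHooks : ∀ {m b r} → IsDistinctPartition (m ∷ b ∷ r) → Nestable m b (nestedHooks r)
nestable-nestedHooks d@(b<m ∷ _ , _) =
  nestedHooks-isPartition (distinct-tail (distinct-tail d)) , hookBound-nestedHooks-≤ (distinct-tail d) , b<m

nestedHooks-injective : ∀ {l l′} → IsDistinctPartition l → IsDistinctPartition l′ →
  nestedHooks l ≡ nestedHooks l′ → l ≡ l′
nestedHooks-injective {[]}        {[]}          _ _ _ = refl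
nestedHooks-injective {[]}        {_ ∷ []}      _ _ ()
nestedHooks-injective {[]}        {_ ∷ _ ∷ _}   _ _ ()
nestedHooks-injective {_ ∷ []}    {[]}          _ _ ()
nestedHooks-injective {_ ∷ _ ∷ _} {[]}          _ _ ()
nestedHooks-injective {_ ∷ []}    {_ ∷ []}      _ _ refl = refl
nestedHooks-injective {_ ∷ []}    {_ ∷ _ ∷ _}   (_ , m>0 ∷ []) d′@(_ , _ ∷ b′>0 ∷ _) eq
  with attachHook-injective (nestable-singleton m>0) (nestable-nestedHooks d′) eq
... | _ , 0≡b′ , _ = ⊥-elim (<-irrefl 0≡b′ b′>0)
nestedHooks-injective {_ ∷ _ ∷ _} {_ ∷ []}      d@(_ , _ ∷ b>0 ∷ _) (_ , m′>0 ∷ []) eq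
  with attachHook-injective (nestable-nestedHooks d) (nestable-singleton m′>0) eq
... | _ , b≡0 , _ = ⊥-elim (<-irrefl (sym b≡0) b>0)
nestedHooks-injective {m ∷ b ∷ _} {_ ∷ _ ∷ _}   d d′ eq
  with attachHook-injective (nestable-nestedHooks d) (nestable-nestedHooks d′) eq
... | refl , refl , ν≡ν′ =
  cong (λ r → m ∷ b ∷ r)
       (nestedHooks-injective (distinct-tail (distinct-tail d)) (distinct-tail (distinct-tail d′)) ν≡ν′)

distinct-∷ : ∀ {b r} → IsDistinctPartition r → hookBound (nestedHooks r) ≤ b → 0 < b →
  IsDistinctPartition (b ∷ r)
distinct-∷ {r = []}    _            _     b>0 = [-] , b>0 ∷ []
distinct-∷ {r = _ ∷ _} d@(lk , ps) ν≤b b>0 =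
  ≤-trans (≤-reflexive (sym (hookBound-nestedHooks d))) ν≤b ∷ lk , b>0 ∷ ps

nestedHooks-attachHook : ∀ {m b r} → IsDistinctPartition r → hookBound (nestedHooks r) ≤ b → b < m →
  ∃ λ l → IsDistinctPartition l × nestedHooks l ≡ attachHook m b (nestedHooks r)
nestedHooks-attachHook {m} {zero} {[]} _ _ m>0 = m ∷ [] , ([-] , m>0 ∷ []) , refl
nestedHooks-attachHook {b = zero} {_ ∷ _} d ν≤0 _ =
  ⊥-elim (n≮0 (subst (_≤ 0) (hookBound-nestedHooks d) ν≤0))
nestedHooks-attachHook {m} {suc b} {r} d ν≤b b<m with distinct-∷ d ν≤b (s≤s z≤n)
... | lk , ps = m ∷ suc b ∷ r , (b<m ∷ lk , ≤-trans (s≤s z≤n) b<m ∷ ps) , refl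

nestedHooks-surjective : ∀ {μ} → IsPartition μ → ∃ λ l → IsDistinctPartition l × nestedHooks l ≡ μ
nestedHooks-surjective {μ} = go (length μ) ≤-refl
  where
  go : ∀ n {μ} → length μ ≤ n → IsPartition μ → ∃ λ l → IsDistinctPartition l × nestedHooks l ≡ μ
  go _ {[]} _ _ = [] , ([] , []) , refl
  go (suc n) {_ ∷ _} (s≤s t≤n) p with attachHook-surjective p
  ... | m , b , ν , (pν , ν≤b , b<m) , ν≤t , attach≡μ with go n (≤-trans ν≤t t≤n) pν
  ... | r , d , refl with nestedHooks-attachHook d ν≤b b<m
  ... | l , dl , nested≡attach = l , dl , trans nested≡attach attach≡μ

IsDistinctOdd : ℕ → ℕ → List ℕ → Set
IsDistinctOdd m n l = IsDistinctPartition l × largestPart l ≡ m × oddPositionSum l ≡ n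

IsHookPartition : ℕ → ℕ → List ℕ → Set
IsHookPartition m n μ = IsPartition μ × sum μ ≡ n × largestHook μ ≡ m

IsDistinctOdd-irrelevant : ∀ m n l → Irrelevant (IsDistinctOdd m n l)
IsDistinctOdd-irrelevant m n l =
  ×-irrelevant (IsDistinctPartition-irrelevant l) (×-irrelevant ≡-irrelevant ≡-irrelevant)

IsHookPartition-irrelevant : ∀ m n μ → Irrelevant (IsHookPartition m n μ)
IsHookPartition-irrelevant m n μ =
  ×-irrelevant (IsPartition-irrelevant μ) (×-irrelevant ≡-irrelevant ≡-irrelevant)

IsHookPartition? : ∀ m n μ → Dec (IsHookPartition m n μ)
IsHookPartition? m n μ = IsPartition? μ ×-dec (sum μ ≟ n ×-dec largestHook μ ≟ m)

distinctOdd↔hookPartitions : ∀ m n → DistinctOdd m n ↔ HookPartitions m n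
distinctOdd↔hookPartitions m n = Σ-↔-bijectiveOn nestedHooks maps injective surjective
  (IsDistinctOdd-irrelevant m n) (IsHookPartition-irrelevant m n)
  where
  maps : ∀ {l} → IsDistinctOdd m n l → IsHookPartition m n (nestedHooks l)
  maps (d , λ₁≡m , odd≡n) =
    nestedHooks-isPartition d , trans (sum-nestedHooks d) odd≡n , trans (largestHook-nestedHooks d) λ₁≡m
  injective : ∀ {l l′} → IsDistinctOdd m n l → IsDistinctOdd m n l′ → nestedHooks l ≡ nestedHooks l′ → l ≡ l′
  injective (d , _) (d′ , _) = nestedHooks-injective d d′
  surjective : ∀ {μ} → IsHookPartition m n μ → ∃ λ l → IsDistinctOdd m n l × nestedHooks l ≡ μ
  surjective (p , sum≡n , hook≡m) with nestedHooks-surjective p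
  ... | l , d , refl =
    l , (d , trans (sym (largestHook-nestedHooks d)) hook≡m , trans (sym (sum-nestedHooks d)) sum≡n) , refl

hookPartitions-finite : ∀ m n → Finite (HookPartitions m n)
hookPartitions-finite m n =
  subset-finite (Bounded-finite (suc n) n) (Bounded-irrelevant (suc n) n) bounded
                (IsHookPartition? m n) (IsHookPartition-irrelevant m n)
  where
  bounded : ∀ {μ} → IsHookPartition m n μ → Bounded (suc n) n μ
  bounded {μ} (p , sum≡n , _) = subst (λ s → Bounded (suc s) s μ) sum≡n (partition-bounded p)

corollary1p6 : (m n : ℕ) →
    Σ ℕ (λ k → (DistinctOdd m n ↔ Fin k) × (HookPartitions m n ↔ Fin k))
corollary1p6 m n with hookPartitions-finite m n
... | k , hooks↔Fin = k , ↔-trans (distinctOdd↔hookPartitions m n) hooks↔Fin , hooks↔Fin
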